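{- Let $F\in\{S,Q,R,T\}$, let $G$ be any simple graph and let $H$ be any dispersable bipartite graph. Then $\operatorname{mbt}(G+_F H)\le \operatorname{mbt}(F(G))+\Delta(H)$, where $\Delta(H)$ is the maximum degree of $H$.
   Context: Matching book embedding: the vertices are placed in a linear order along a spine and each edge is assigned to a page (half-plane bounded by the spine) so that no two edges on the same page cross and every vertex is incident with at most one edge on each page. $\operatorname{mbt}(G)$ is the minimum number of pages of a matching book embedding of $G$. $G$ is dispersable if $\operatorname{mbt}(G)=\Delta(G)$. For a graph $G$: $S(G)$ is obtained by inserting a new vertex into each edge of $G$, so each edge becomes a path of length 2. $R(G)$ is obtained from $G$ by adding, for each edge $uv$, a new vertex adjacent to both $u$ and $v$; the original edges are kept. $Q(G)$ is obtained by inserting a new vertex into each edge of $G$ and then joining two new vertices whenever their edges of $G$ share an endpoint. $T(G)$ has vertex set $V(G)\cup E(G)$; two elements are adjacent if they are adjacent vertices of $G$, adjacent edges of $G$ (sharing an endpoint), or a vertex and an edge incident with it. In each case $V(F(G))=V(G)\cup E(G)$, where each edge of $G$ is identified with its new vertex. The $F$-sum $G+_F H$ has vertex set $(V(G)\cup E(G))\times V(H)$. Two vertices $(u_1,u_2)$ and $(v_1,v_2)$ are adjacent if and only if either $u_1=v_1\in V(G)$ and $u_2v_2\in E(H)$, or $u_2=v_2$ and $u_1v_1\in E(F(G))$. -}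

module Defs where

open import Data.Nat using (ℕ; _<_; _⊔_; _≤_)
open import Data.Fin using (Fin; toℕ)
import Data.Fin as Fin
open import Data.Bool using (Bool; true; false; _∧_; _∨_; not; if_then_else_)
open import Data.Sum using (_⊎_; inj₁; inj₂)
open import Data.Product using (Σ; _×_; _,_; ∃)
open import Data.List using (List; map; foldr; allFin)
open import Data.Nat.ListAction using (sum)
open import Data.Empty using (⊥)
open import Relation.Nullary using (¬_)
open import Relation.Nullary.Decidable using (⌊_⌋)
open import Relation.Binary.PropositionalEquality using (_≡_; _≢_)

record SimpleGraph (n : ℕ) : Set where
  field
    adj    : Fin n → Fin n → Bool
    sym    : ∀ u v → adj u v ≡ adj v u
    irrefl : ∀ v → adj v v ≡ false
open SimpleGraph public

_==_ : ∀ {n} → Fin n → Fin n → Bool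
i == j = ⌊ i Fin.≟ j ⌋

degree : ∀ {n} → SimpleGraph n → Fin n → ℕ
degree {n} H v = sum (map (λ u → if adj H v u then 1 else 0) (allFin n))

Δ : ∀ {n} → SimpleGraph n → ℕ
Δ {n} H = foldr _⊔_ 0 (map (degree H) (allFin n))

Bipartite : ∀ {n} → SimpleGraph n → Set
Bipartite {n} H = Σ (Fin n → Bool) λ c → ∀ u v → adj H u v ≡ true → c u ≢ c v

record Graph : Set₁ where
  field
    V   : Set
    Adj : V → V → Bool

toGraph : ∀ {n} → SimpleGraph n → Graph
toGraph {n} G = record { V = Fin n ; Adj = adj G }

-- Matching book embedding with k pages: vertices placed on the spine
-- by an injective position map, each edge gets a page (symmetric in
-- its ends); no vertex has two edges on the same page; no two edges
-- on the same page cross (a < c < b < d).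
record MBE (X : Graph) (k : ℕ) : Set where
  open Graph X
  field
    pos      : V → ℕ
    pos-inj  : ∀ u v → pos u ≡ pos v → u ≡ v
    page     : V → V → Fin k
    page-sym : ∀ u v → Adj u v ≡ true → page u v ≡ page v u
    matching : ∀ u v w → Adj u v ≡ true → Adj u w ≡ true →
               page u v ≡ page u w → v ≡ w
    noncross : ∀ a b c d → Adj a b ≡ true → Adj c d ≡ true →
               page a b ≡ page c d →
               pos a < pos c → pos c < pos b → pos b < pos d → ⊥

IsMbt : Graph → ℕ → Set
IsMbt X k = MBE X k × (∀ j → MBE X j → k ≤ j)

Dispersable : ∀ {n} → SimpleGraph n → Set
Dispersable H = IsMbt (toGraph H) (Δ H)

record Edge {m : ℕ} (G : SimpleGraph m) : Set where
  constructor edge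
  field
    a b  : Fin m
    a<b  : toℕ a < toℕ b
    adj∈ : adj G a b ≡ true
open Edge public

incident : ∀ {m} {G : SimpleGraph m} → Fin m → Edge G → Bool
incident v e = (v == a e) ∨ (v == b e)

sameEdge : ∀ {m} {G : SimpleGraph m} → Edge G → Edge G → Bool
sameEdge e f = (a e == a f) ∧ (b e == b f)

adjEdges : ∀ {m} {G : SimpleGraph m} → Edge G → Edge G → Bool
adjEdges e f = not (sameEdge e f) ∧
  ((a e == a f) ∨ (a e == b f) ∨ (b e == a f) ∨ (b e == b f))

VE : ∀ {m} → SimpleGraph m → Set
VE {m} G = Fin m ⊎ Edge G

data Op : Set where S Q R T : Op

adjF : Op → ∀ {m} (G : SimpleGraph m) → VE G → VE G → Bool
adjF S G (inj₁ u) (inj₁ v) = false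
adjF S G (inj₁ u) (inj₂ e) = incident u e
adjF S G (inj₂ e) (inj₁ v) = incident v e
adjF S G (inj₂ e) (inj₂ f) = false
adjF R G (inj₁ u) (inj₁ v) = adj G u v
adjF R G (inj₁ u) (inj₂ e) = incident u e
adjF R G (inj₂ e) (inj₁ v) = incident v e
adjF R G (inj₂ e) (inj₂ f) = false
adjF Q G (inj₁ u) (inj₁ v) = false
adjF Q G (inj₁ u) (inj₂ e) = incident u e
adjF Q G (inj₂ e) (inj₁ v) = incident v e
adjF Q G (inj₂ e) (inj₂ f) = adjEdges e f
adjF T G (inj₁ u) (inj₁ v) = adj G u v
adjF T G (inj₁ u) (inj₂ e) = incident u e
adjF T G (inj₂ e) (inj₁ v) = incident v e
adjF T G (inj₂ e) (inj₂ f) = adjEdges e f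

FGraph : Op → ∀ {m} → SimpleGraph m → Graph
FGraph F G = record { V = VE G ; Adj = adjF F G }

sameV : ∀ {m} {G : SimpleGraph m} → VE G → VE G → Bool
sameV (inj₁ u) (inj₁ v) = u == v
sameV _ _ = false

FSum : Op → ∀ {m n} → SimpleGraph m → SimpleGraph n → Graph
FSum F {m} {n} G H = record
  { V   = VE G × Fin n
  ; Adj = λ { (x , i) (y , j) →
            (sameV x y ∧ adj H i j) ∨ ((i == j) ∧ adjF F G x y) } }

-- The spine of G +_F H is laid out in blocks, one for each vertex i of H, in
-- the spine order of a dispersable embedding of H; block i is a copy of the
-- spine of F(G), mirrored when i lies in the second colour class.  Edges
-- inside a block use the mbt(F(G)) pages of F(G), edges between blocks the
-- Δ(H) pages of H.  Two inter-block edges on a common page can only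
-- interleave if they lie over the same edge ij of H; but i and j have
-- different colours, so the two edges appear in opposite orders in blocks i
-- and j and therefore nest.  Nothing about F(G) is used beyond the symmetry
-- of its adjacency and the finiteness of its vertex set.
module Submission where

open import Defs hiding (sym)
open import Data.Nat using (ℕ; _≤_; _+_)
open import Data.Nat.Base using (_<_; _*_; _∸_; _⊔_; suc; zero; s≤s)
open import Data.Nat.Properties
open import Data.Nat.DivMod using (_/_; _%_; [m+kn]%n≡m%n; m≤n⇒m%n≡m; m<n⇒m/n≡0; m*n/n≡m; +-distrib-/-∣ʳ; /-monoˡ-≤)
open import Data.Nat.Divisibility using (n∣m*n)
open import Data.Fin using (Fin; toℕ; _↑ˡ_; _↑ʳ_; splitAt)
import Data.Fin as Fin
open import Data.Fin.Properties using (↑ˡ-injective; ↑ʳ-injective; splitAt-↑ˡ; splitAt-↑ʳ)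
open import Data.Bool using (Bool; true; false; _∧_; _∨_; not; if_then_else_)
import Data.Bool as Bool
open import Data.Bool.Properties using (∨-assoc; ∨-comm)
open import Data.Maybe using (Maybe; just; nothing; maybe′)
open import Data.Sum using (_⊎_; inj₁; inj₂)
open import Data.Product using (Σ; _×_; _,_; proj₁; proj₂; uncurry)
open import Data.Empty using (⊥; ⊥-elim)
open import Relation.Nullary using (yes; no)
open import Relation.Binary.PropositionalEquality
open import Axiom.UniquenessOfIdentityProofs using (module Decidable⇒UIP)

∨-true : ∀ {x y} → x ∨ y ≡ true → x ≡ true ⊎ y ≡ true
∨-true {true}  _ = inj₁ refl
∨-true {false} e = inj₂ e

∧-true : ∀ {x y} → x ∧ y ≡ true → x ≡ true × y ≡ true
∧-true {true} e = refl , e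

∨-swap-middle : ∀ x y z w → x ∨ y ∨ z ∨ w ≡ x ∨ z ∨ y ∨ w
∨-swap-middle x y z w = cong (x ∨_) (begin
  y ∨ z ∨ w     ≡⟨ ∨-assoc y z w ⟨
  (y ∨ z) ∨ w   ≡⟨ cong (_∨ w) (∨-comm y z) ⟩
  (z ∨ y) ∨ w   ≡⟨ ∨-assoc z y w ⟩
  z ∨ y ∨ w     ∎)
  where open ≡-Reasoning

==⇒≡ : ∀ {m} {i j : Fin m} → (i == j) ≡ true → i ≡ j
==⇒≡ {i = i} {j} e with i Fin.≟ j
... | yes i≡j = i≡j

==-sym : ∀ {m} (i j : Fin m) → (i == j) ≡ (j == i)
==-sym i j with i Fin.≟ j | j Fin.≟ i
... | yes _   | yes _   = refl
... | no _    | no _    = refl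
... | yes i≡j | no j≢i  = ⊥-elim (j≢i (sym i≡j))
... | no i≢j  | yes j≡i = ⊥-elim (i≢j (sym j≡i))

↑ˡ≢↑ʳ : ∀ {k} d {x : Fin k} {y : Fin d} → x ↑ˡ d ≢ k ↑ʳ y
↑ˡ≢↑ʳ {k} d {x} {y} e
  with () ← trans (sym (splitAt-↑ˡ k x d)) (trans (cong (splitAt k) e) (splitAt-↑ʳ k d y))

Bounded : {A : Set} → (A → ℕ) → Set
Bounded f = Σ ℕ λ B → ∀ a → f a ≤ B

-- A weak, constructive form of finiteness; it is all the layout needs.
Finite : Set → Set
Finite A = (f : A → ℕ) → Bounded f

Fin-finite : ∀ {n} → Finite (Fin n)
Fin-finite {zero}  f = 0 , λ ()
Fin-finite {suc n} f with Fin-finite (λ i → f (Fin.suc i))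
... | B , f≤B = f Fin.zero ⊔ B , λ
  { Fin.zero    → m≤m⊔n _ _
  ; (Fin.suc i) → ≤-trans (f≤B i) (m≤n⊔m _ _) }

⊎-finite : ∀ {A C} → Finite A → Finite C → Finite (A ⊎ C)
⊎-finite finA finC f with finA (λ a → f (inj₁ a)) | finC (λ c → f (inj₂ c))
... | B , fa≤B | B' , fc≤B' = B ⊔ B' , λ
  { (inj₁ a) → ≤-trans (fa≤B a) (m≤m⊔n B B')
  ; (inj₂ c) → ≤-trans (fc≤B' c) (m≤n⊔m B B') }

×-finite : ∀ {A C} → Finite A → Finite C → Finite (A × C)
×-finite finA finC f with finA (λ a → proj₁ (finC (λ c → f (a , c))))
... | B , rows≤B = B , λ (a , c) → ≤-trans (proj₂ (finC (λ c → f (a , c))) c) (rows≤B a)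

retract-finite : ∀ {A C} (s : A → C) (r : C → Maybe A) → (∀ a → r (s a) ≡ just a) →
                 Finite C → Finite A
retract-finite s r r∘s finC f with finC (λ c → maybe′ f 0 (r c))
... | B , g≤B = B , λ a → subst (_≤ B) (cong (maybe′ f 0) (r∘s a)) (g≤B (s a))

module _ {m} {G : SimpleGraph m} where

  edge-≡ : {e e' : Edge G} → a e ≡ a e' → b e ≡ b e' → e ≡ e'
  edge-≡ {edge x y x<y xy} {edge _ _ x<y' xy'} refl refl =
    cong₂ (edge x y) (<-irrelevant x<y x<y') (Decidable⇒UIP.≡-irrelevant Bool._≟_ xy xy')

  toEdge : Fin m → Fin m → Maybe (Edge G)
  toEdge x y with toℕ x <? toℕ y | adj G x y Bool.≟ true
  ... | yes x<y | yes xy = just (edge x y x<y xy)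
  ... | _       | _      = nothing

  toEdge-endpoints : (e : Edge G) → toEdge (a e) (b e) ≡ just e
  toEdge-endpoints (edge x y x<y xy) with toℕ x <? toℕ y | adj G x y Bool.≟ true
  ... | yes _   | yes _   = cong just (edge-≡ refl refl)
  ... | no x≮y  | _       = ⊥-elim (x≮y x<y)
  ... | yes _   | no ¬xy  = ⊥-elim (¬xy xy)

  VE-finite : Finite (VE G)
  VE-finite = ⊎-finite Fin-finite
    (retract-finite (λ e → a e , b e) (uncurry toEdge) toEdge-endpoints
                    (×-finite Fin-finite Fin-finite))

-- The spine position of the vertex with offset r ≤ B in block a.
lex : ℕ → ℕ → ℕ → ℕ
lex B a r = r + a * suc B

lex-block : ∀ {B r} a → r ≤ B → lex B a r / suc B ≡ a
lex-block {B} {r} a r≤B = begin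
  (r + a * suc B) / suc B        ≡⟨ +-distrib-/-∣ʳ r (n∣m*n a) ⟩
  r / suc B + a * suc B / suc B  ≡⟨ cong₂ _+_ (m<n⇒m/n≡0 (s≤s r≤B)) (m*n/n≡m a (suc B)) ⟩
  a                              ∎
  where open ≡-Reasoning

lex-offset : ∀ {B r} a → r ≤ B → lex B a r % suc B ≡ r
lex-offset {B} {r} a r≤B = trans ([m+kn]%n≡m%n r a (suc B)) (m≤n⇒m%n≡m r≤B)

module _ {B r r' : ℕ} (r≤B : r ≤ B) (r'≤B : r' ≤ B) where

  lex-injective : ∀ {a a'} → lex B a r ≡ lex B a' r' → a ≡ a' × r ≡ r'
  lex-injective {a} {a'} e =
    trans (sym (lex-block a r≤B)) (trans (cong (_/ suc B) e) (lex-block a' r'≤B)) ,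
    trans (sym (lex-offset a r≤B)) (trans (cong (_% suc B) e) (lex-offset a' r'≤B))

  lex-<⇒block-≤ : ∀ {a a'} → lex B a r < lex B a' r' → a ≤ a'
  lex-<⇒block-≤ {a} {a'} lt =
    subst₂ _≤_ (lex-block a r≤B) (lex-block a' r'≤B) (/-monoˡ-≤ (suc B) (<⇒≤ lt))

orient : ℕ → Bool → ℕ → ℕ
orient B true  p = p
orient B false p = B ∸ p

orient-≤ : ∀ {B p} c → p ≤ B → orient B c p ≤ B
orient-≤ true  p≤B = p≤B
orient-≤ {B} {p} false _ = m∸n≤m B p

orient-injective : ∀ {B p p'} c → p ≤ B → p' ≤ B → orient B c p ≡ orient B c p' → p ≡ p'
orient-injective true  _   _    e = e
orient-injective false p≤B p'≤B e = ∸-cancelˡ-≡ p≤B p'≤B e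

∸-<⇒> : ∀ {B p p'} → B ∸ p < B ∸ p' → p' < p
∸-<⇒> {B} {p} {p'} lt with p' <? p
... | yes p'<p = p'<p
... | no p'≮p  = ⊥-elim (<⇒≱ lt (∸-monoʳ-≤ B (≮⇒≥ p'≮p)))

orient-opposite : ∀ {B p p' c c'} → c ≢ c' →
                  orient B c p < orient B c p' → orient B c' p < orient B c' p' → ⊥
orient-opposite {c = true}  {true}  c≢c' _  _  = c≢c' refl
orient-opposite {c = false} {false} c≢c' _  _  = c≢c' refl
orient-opposite {c = true}  {false} _    lt gt = <-asym lt (∸-<⇒> gt)
orient-opposite {c = false} {true}  _    gt lt = <-asym lt (∸-<⇒> gt)

Symmetric : Graph → Set
Symmetric X = ∀ u v → Graph.Adj X u v ≡ true → Graph.Adj X v u ≡ true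

module _ {X : Graph} (symX : Symmetric X) {k} (M : MBE X k) where
  open Graph X
  open MBE M

  mirror-noncross : ∀ {u v x y} → Adj u v ≡ true → Adj x y ≡ true → page u v ≡ page x y →
                    pos y < pos v → pos v < pos x → pos x < pos u → ⊥
  mirror-noncross {u} {v} {x} {y} uv xy same =
    noncross y x v u (symX x y xy) (symX u v uv)
      (trans (page-sym y x (symX x y xy)) (trans (sym same) (page-sym u v uv)))

  -- Strict interleaving is a crossing; a coincidence of ends forces the two
  -- edges to agree by the matching condition.
  weakly-crossing⇒same : ∀ {i j i' j'} → Adj i j ≡ true → Adj i' j' ≡ true →
                         page i j ≡ page i' j' →
                         pos i ≤ pos i' → pos i' ≤ pos j → pos j ≤ pos j' → i ≡ i' × j ≡ j'
  weakly-crossing⇒same {i} {j} {i'} {j'} ij i'j' same i≤i' i'≤j j≤j'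
    with m≤n⇒m<n∨m≡n i≤i' | m≤n⇒m<n∨m≡n i'≤j | m≤n⇒m<n∨m≡n j≤j'
  ... | inj₂ i≡i' | _ | _ with refl ← pos-inj i i' i≡i' = refl , matching i j j' ij i'j' same
  ... | inj₁ i<i' | inj₁ i'<j | inj₁ j<j' = ⊥-elim (noncross i j i' j' ij i'j' same i<i' i'<j j<j')
  ... | inj₁ i<i' | inj₂ i'≡j | _ with refl ← pos-inj i' j i'≡j
    with refl ← matching i' i j' (symX i i' ij) i'j' (trans (sym (page-sym i i' ij)) same)
    = ⊥-elim (<⇒≱ i<i' j≤j')
  ... | inj₁ i<i' | inj₁ _ | inj₂ j≡j' with refl ← pos-inj j j' j≡j'
    with refl ← matching j i i' (symX i j ij) (symX i' j i'j')
                  (trans (sym (page-sym i j ij)) (trans same (page-sym i' j i'j')))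
    = ⊥-elim (<-irrefl refl i<i')

data CartesianEdge (X : Graph) {n} (Y : SimpleGraph n) :
                   Graph.V X × Fin n → Graph.V X × Fin n → Set where
  fibre : ∀ x {i j} → adj Y i j ≡ true → CartesianEdge X Y (x , i) (x , j)
  layer : ∀ {x y} i → Graph.Adj X x y ≡ true → CartesianEdge X Y (x , i) (y , i)

module CartesianLayout
  (X : Graph) (symX : Symmetric X) {k} (MX : MBE X k) (B : ℕ) (MX-pos≤B : ∀ x → MBE.pos MX x ≤ B)
  {n} (Y : SimpleGraph n) (colour : Fin n → Bool) (proper : ∀ i j → adj Y i j ≡ true → colour i ≢ colour j)
  {d} (MY : MBE (toGraph Y) d)
  (A : Graph.V X × Fin n → Graph.V X × Fin n → Bool)
  (A-cartesian : ∀ p q → A p q ≡ true → CartesianEdge X Y p q) where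

  module MX = MBE MX
  module MY = MBE MY

  Vertex : Set
  Vertex = Graph.V X × Fin n

  Z : Graph
  Z = record { V = Vertex ; Adj = A }

  symY : Symmetric (toGraph Y)
  symY i j ij = trans (SimpleGraph.sym Y j i) ij

  offset : Vertex → ℕ
  offset (x , i) = orient B (colour i) (MX.pos x)

  offset≤B : ∀ p → offset p ≤ B
  offset≤B (x , i) = orient-≤ (colour i) (MX-pos≤B x)

  pos : Vertex → ℕ
  pos (x , i) = lex B (MY.pos i) (offset (x , i))

  pos-injective : ∀ p q → pos p ≡ pos q → p ≡ q
  pos-injective p@(x , i) q@(y , j) e with lex-injective (offset≤B p) (offset≤B q) e
  ... | blocks , offsets with refl ← MY.pos-inj i j blocks
    with refl ← MX.pos-inj x y (orient-injective (colour i) (MX-pos≤B x) (MX-pos≤B y) offsets)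
    = refl

  block-≤ : ∀ {p q} → pos p < pos q → MY.pos (proj₂ p) ≤ MY.pos (proj₂ q)
  block-≤ {p} {q} = lex-<⇒block-≤ (offset≤B p) (offset≤B q)

  offset-< : ∀ {x y i} → pos (x , i) < pos (y , i) → offset (x , i) < offset (y , i)
  offset-< {i = i} = +-cancelʳ-< (MY.pos i * suc B) _ _

  page : Vertex → Vertex → Fin (k + d)
  page (x , i) (y , j) = if adj Y i j then k ↑ʳ MY.page i j else MX.page x y ↑ˡ d

  page-fibre : ∀ {x y i j} → adj Y i j ≡ true → page (x , i) (y , j) ≡ k ↑ʳ MY.page i j
  page-fibre ij rewrite ij = refl

  page-layer : ∀ {x y} i → page (x , i) (y , i) ≡ MX.page x y ↑ˡ d
  page-layer i rewrite SimpleGraph.irrefl Y i = refl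

  fibre-pages : ∀ {x y x' y' i j i' j'} → adj Y i j ≡ true → adj Y i' j' ≡ true →
                page (x , i) (y , j) ≡ page (x' , i') (y' , j') → MY.page i j ≡ MY.page i' j'
  fibre-pages ij i'j' same =
    ↑ʳ-injective k _ _ (trans (sym (page-fibre ij)) (trans same (page-fibre i'j')))

  layer-pages : ∀ {x y x' y'} i i' → page (x , i) (y , i) ≡ page (x' , i') (y' , i') →
                MX.page x y ≡ MX.page x' y'
  layer-pages i i' same =
    ↑ˡ-injective d _ _ (trans (sym (page-layer i)) (trans same (page-layer i')))

  fibre≢layer : ∀ {x y x' y' i j} i' → adj Y i j ≡ true →
                page (x , i) (y , j) ≢ page (x' , i') (y' , i')
  fibre≢layer i' ij same = ↑ˡ≢↑ʳ d (trans (sym (page-layer i')) (trans (sym same) (page-fibre ij)))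

  page-sym : ∀ p q → A p q ≡ true → page p q ≡ page q p
  page-sym p q pq with A-cartesian p q pq
  ... | fibre x {i} {j} ij = begin
    page (x , i) (x , j)  ≡⟨ page-fibre ij ⟩
    k ↑ʳ MY.page i j      ≡⟨ cong (k ↑ʳ_) (MY.page-sym i j ij) ⟩
    k ↑ʳ MY.page j i      ≡⟨ page-fibre (symY i j ij) ⟨
    page (x , j) (x , i)  ∎
    where open ≡-Reasoning
  ... | layer {x} {y} i xy = begin
    page (x , i) (y , i)  ≡⟨ page-layer i ⟩
    MX.page x y ↑ˡ d      ≡⟨ cong (_↑ˡ d) (MX.page-sym x y xy) ⟩
    MX.page y x ↑ˡ d      ≡⟨ page-layer i ⟨
    page (y , i) (x , i)  ∎
    where open ≡-Reasoning

  matching : ∀ p q r → A p q ≡ true → A p r ≡ true → page p q ≡ page p r → q ≡ r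
  matching p q r pq pr same with A-cartesian p q pq | A-cartesian p r pr
  ... | fibre x ij | fibre _ ij' = cong (x ,_) (MY.matching _ _ _ ij ij' (fibre-pages ij ij' same))
  ... | fibre _ ij | layer i _   = ⊥-elim (fibre≢layer i ij same)
  ... | layer i _  | fibre _ ij' = ⊥-elim (fibre≢layer i ij' (sym same))
  ... | layer i xy | layer _ xz  = cong (_, i) (MX.matching _ _ _ xy xz (layer-pages i i same))

  layer-noncross : ∀ {x y z w} c → Graph.Adj X x y ≡ true → Graph.Adj X z w ≡ true →
                   MX.page x y ≡ MX.page z w →
                   orient B c (MX.pos x) < orient B c (MX.pos z) →
                   orient B c (MX.pos z) < orient B c (MX.pos y) →
                   orient B c (MX.pos y) < orient B c (MX.pos w) → ⊥
  layer-noncross true  xy zw same l₁ l₂ l₃ = MX.noncross _ _ _ _ xy zw same l₁ l₂ l₃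
  layer-noncross false xy zw same l₁ l₂ l₃ =
    mirror-noncross symX MX xy zw same (∸-<⇒> l₃) (∸-<⇒> l₂) (∸-<⇒> l₁)

  noncross : ∀ p q r s → A p q ≡ true → A r s ≡ true → page p q ≡ page r s →
             pos p < pos r → pos r < pos q → pos q < pos s → ⊥
  noncross p q r s pq rs same l₁ l₂ l₃ with A-cartesian p q pq | A-cartesian r s rs
  ... | fibre u ij | fibre v ij'
    with refl , refl ← weakly-crossing⇒same symY MY ij ij' (fibre-pages ij ij' same)
                         (block-≤ l₁) (block-≤ l₂) (block-≤ l₃)
    = orient-opposite (proper _ _ ij) (offset-< l₁) (offset-< l₃)
  ... | fibre _ ij | layer i' _  = fibre≢layer i' ij same
  ... | layer i _  | fibre _ ij' = fibre≢layer i ij' (sym same)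
  ... | layer i xy | layer i' zw
    with refl ← MY.pos-inj i i' (≤-antisym (block-≤ l₁) (block-≤ l₂))
    = layer-noncross (colour i) xy zw (layer-pages i i same) (offset-< l₁) (offset-< l₂) (offset-< l₃)

  mbe : MBE Z (k + d)
  mbe = record
    { pos = pos ; pos-inj = pos-injective ; page = page ; page-sym = page-sym
    ; matching = matching ; noncross = noncross }

cartesian-MBE : (X : Graph) → Symmetric X → ∀ {k} (MX : MBE X k) → Bounded (MBE.pos MX) →
                ∀ {n} (Y : SimpleGraph n) → Bipartite Y → ∀ {d} → MBE (toGraph Y) d →
                (A : Graph.V X × Fin n → Graph.V X × Fin n → Bool) →
                (∀ p q → A p q ≡ true → CartesianEdge X Y p q) →
                MBE (record { V = Graph.V X × Fin n ; Adj = A }) (k + d)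
cartesian-MBE X symX MX (B , pos≤B) Y (colour , proper) MY A A-cartesian =
  CartesianLayout.mbe X symX MX B pos≤B Y colour proper MY A A-cartesian

sameEdge-sym : ∀ {m} {G : SimpleGraph m} (e f : Edge G) → sameEdge e f ≡ sameEdge f e
sameEdge-sym e f rewrite ==-sym (a e) (a f) | ==-sym (b e) (b f) = refl

adjEdges-sym : ∀ {m} {G : SimpleGraph m} (e f : Edge G) → adjEdges e f ≡ adjEdges f e
adjEdges-sym e f
  rewrite sameEdge-sym e f | ==-sym (a e) (a f) | ==-sym (a e) (b f)
        | ==-sym (b e) (a f) | ==-sym (b e) (b f)
  = cong (not (sameEdge f e) ∧_) (∨-swap-middle (a f == a e) (b f == a e) (a f == b e) (b f == b e))

adjF-sym : ∀ F {m} (G : SimpleGraph m) x y → adjF F G x y ≡ adjF F G y x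
adjF-sym S G (inj₁ u) (inj₁ v) = refl
adjF-sym S G (inj₁ u) (inj₂ e) = refl
adjF-sym S G (inj₂ e) (inj₁ v) = refl
adjF-sym S G (inj₂ e) (inj₂ f) = refl
adjF-sym Q G (inj₁ u) (inj₁ v) = refl
adjF-sym Q G (inj₁ u) (inj₂ e) = refl
adjF-sym Q G (inj₂ e) (inj₁ v) = refl
adjF-sym Q G (inj₂ e) (inj₂ f) = adjEdges-sym e f
adjF-sym R G (inj₁ u) (inj₁ v) = SimpleGraph.sym G u v
adjF-sym R G (inj₁ u) (inj₂ e) = refl
adjF-sym R G (inj₂ e) (inj₁ v) = refl
adjF-sym R G (inj₂ e) (inj₂ f) = refl
adjF-sym T G (inj₁ u) (inj₁ v) = SimpleGraph.sym G u v
adjF-sym T G (inj₁ u) (inj₂ e) = refl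
adjF-sym T G (inj₂ e) (inj₁ v) = refl
adjF-sym T G (inj₂ e) (inj₂ f) = adjEdges-sym e f

FGraph-symmetric : ∀ F {m} (G : SimpleGraph m) → Symmetric (FGraph F G)
FGraph-symmetric F G x y xy = trans (adjF-sym F G y x) xy

sameV⇒≡ : ∀ {m} {G : SimpleGraph m} {x y : VE G} → sameV x y ≡ true → x ≡ y
sameV⇒≡ {x = inj₁ u} {inj₁ v} e = cong inj₁ (==⇒≡ e)

FSum-cartesian : ∀ F {m n} (G : SimpleGraph m) (H : SimpleGraph n) p q →
                 Graph.Adj (FSum F G H) p q ≡ true → CartesianEdge (FGraph F G) H p q
FSum-cartesian F G H (x , i) (y , j) e with ∨-true {sameV x y ∧ adj H i j} e
... | inj₁ fib with ∧-true {sameV x y} fib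
... | x≈y , ij with refl ← sameV⇒≡ {x = x} {y} x≈y = fibre x ij
FSum-cartesian F G H (x , i) (y , j) e | inj₂ lay with ∧-true {i == j} lay
... | i≈j , xy with refl ← ==⇒≡ {i = i} {j} i≈j = layer i xy

theorem3p2 : (F : Op) → ∀ {m n} (G : SimpleGraph m) (H : SimpleGraph n) →
    Bipartite H → Dispersable H →
    ∀ k k' → IsMbt (FGraph F G) k → IsMbt (FSum F G H) k' →
    k' ≤ k + Δ H
theorem3p2 F G H bipartite (MH , _) k k' (MF , _) (_ , minimal) =
  minimal (k + Δ H)
    (cartesian-MBE (FGraph F G) (FGraph-symmetric F G) MF (VE-finite (MBE.pos MF))
                   H bipartite MH (Graph.Adj (FSum F G H)) (FSum-cartesian F G H))
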